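{- Let $S$ and $T$ be non-empty bitstrings of the same length, and let $S=S_0,S_1,S_2,\dots$ and $T=T_0,T_1,T_2,\dots$ be obtained by repeatedly applying the Wythoff Update ($S_{i+1}$ is the Wythoff Update of $S_i$, and likewise for $T$). Then there exists $t\ge0$ such that $S_t$ and $T_t$ are balanced.
   Context: The Wythoff Update of a non-empty bitstring $S$: if the first character is $0$, change it to $1$ and append $0$ at the right end; if the first character is $1$, remove it and append $01$ at the right end. Two bitstrings are balanced if they have the same length and the same number of ones. -}

module Defs where

open import Data.Bool using (Bool; true; false)
open import Data.List using (List; []; _∷_; _++_; length; filter; [_])
open import Data.Nat using (ℕ; zero; suc)
open import Data.Product using (_×_)
open import Relation.Binary.PropositionalEquality using (_≡_)

-- Bitstrings: lists of bits, false = 0, true = 1.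
Bitstring : Set
Bitstring = List Bool

-- The Wythoff Update. On the empty string (outside its domain) it is
-- the identity; non-emptiness is preserved by the update, so this case
-- never arises for the iterates of a non-empty string.
wythoff : Bitstring → Bitstring
wythoff []          = []
wythoff (false ∷ s) = (true ∷ s) ++ (false ∷ [])
wythoff (true ∷ s)  = s ++ (false ∷ true ∷ [])

iterate : ℕ → Bitstring → Bitstring
iterate zero    s = s
iterate (suc i) s = wythoff (iterate i s)

ones : Bitstring → ℕ
ones []          = 0
ones (true ∷ s)  = suc (ones s)
ones (false ∷ s) = ones s

Balanced : Bitstring → Bitstring → Set
Balanced s t = (length s ≡ length t) × (ones s ≡ ones t)

-- Reading a bitstring x as a queue, the update consumes its first bit and
-- appends a code word: after cost x steps (two per 0, one per 1) the string
-- x ++ y has become y ++ expand x, where expand replaces 0 by 001 and 1 by 01.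
-- Each step adds at most one 0, and a step that ends a code word adds exactly
-- one.  Suppose S and T have equal length and S has D > 0 more zeros.  Then
-- cost S = cost T + D, and after cost T steps T has become expand T with
-- cost T zeros, while S will reach cost S = cost T + D zeros only D steps
-- later, the last of them adding a zero.  So S is then ahead of T by at most
-- D - 1 and at least 0 zeros, and the surplus reaches 0 by induction on D.
module Submission where

open import Defs
open import Data.Bool using (true; false)
open import Data.List using ([]; _∷_; _++_; _∷ʳ_; length)
open import Data.List.Properties using (++-assoc; ++-identityʳ; ++-conicalʳ; length-++; ∷ʳ-injectiveʳ)
open import Data.Nat using (ℕ; zero; suc; _+_; _≤_; _<_; s≤s)
open import Data.Nat.Induction using (<-wellFounded)
open import Data.Nat.Properties
open import Data.Product using (∃-syntax; _×_; _,_; proj₁; proj₂)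
open import Data.Sum using (inj₁; inj₂)
open import Function using (_∘′_)
open import Induction.WellFounded using (Acc; acc)
open import Relation.Binary.PropositionalEquality
open ≡-Reasoning

zeros : Bitstring → ℕ
zeros []          = 0
zeros (true ∷ s)  = zeros s
zeros (false ∷ s) = suc (zeros s)

zeros-++ : ∀ s t → zeros (s ++ t) ≡ zeros s + zeros t
zeros-++ []          t = refl
zeros-++ (true ∷ s)  t = zeros-++ s t
zeros-++ (false ∷ s) t = cong suc (zeros-++ s t)

ones+zeros≡length : ∀ s → ones s + zeros s ≡ length s
ones+zeros≡length []          = refl
ones+zeros≡length (true ∷ s)  = cong suc (ones+zeros≡length s)
ones+zeros≡length (false ∷ s) = trans (+-suc (ones s) (zeros s)) (cong suc (ones+zeros≡length s))

balanced-by-zeros : ∀ {s t} → length s ≡ length t → zeros s ≡ zeros t → Balanced s t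
balanced-by-zeros {s} {t} l z = l , +-cancelʳ-≡ (zeros t) (ones s) (ones t) (begin
  ones s + zeros t ≡⟨ cong (ones s +_) (sym z) ⟩
  ones s + zeros s ≡⟨ ones+zeros≡length s ⟩
  length s         ≡⟨ l ⟩
  length t         ≡⟨ sym (ones+zeros≡length t) ⟩
  ones t + zeros t ∎)

Balanced-sym : ∀ {s t} → Balanced s t → Balanced t s
Balanced-sym (l , o) = sym l , sym o

length-wythoff-∷ : ∀ c s → length (wythoff (c ∷ s)) ≡ suc (suc (length s))
length-wythoff-∷ false s = cong suc (trans (length-++ s) (+-comm (length s) 1))
length-wythoff-∷ true  s = trans (length-++ s) (+-comm (length s) 2)

zeros-wythoff-∷ : ∀ c s → zeros (wythoff (c ∷ s)) ≡ suc (zeros s)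
zeros-wythoff-∷ false s = trans (zeros-++ s _) (+-comm (zeros s) 1)
zeros-wythoff-∷ true  s = trans (zeros-++ s _) (+-comm (zeros s) 1)

zeros≤zeros-wythoff : ∀ s → zeros s ≤ zeros (wythoff s)
zeros≤zeros-wythoff []          = ≤-refl
zeros≤zeros-wythoff (false ∷ s) = ≤-reflexive (sym (zeros-wythoff-∷ false s))
zeros≤zeros-wythoff (true ∷ s)  = ≤-trans (n≤1+n (zeros s)) (≤-reflexive (sym (zeros-wythoff-∷ true s)))

zeros-wythoff≤ : ∀ s → zeros (wythoff s) ≤ suc (zeros s)
zeros-wythoff≤ []          = n≤1+n 0
zeros-wythoff≤ (false ∷ s) = ≤-trans (≤-reflexive (zeros-wythoff-∷ false s)) (n≤1+n _)
zeros-wythoff≤ (true ∷ s)  = ≤-reflexive (zeros-wythoff-∷ true s)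

-- Only an update consuming a leading 1 can produce a string ending in 1.
zeros-wythoff-∷ʳ-true : ∀ s r → wythoff s ≡ r ∷ʳ true → zeros (wythoff s) ≡ suc (zeros s)
zeros-wythoff-∷ʳ-true []          r eq with () ← ++-conicalʳ r _ (sym eq)
zeros-wythoff-∷ʳ-true (false ∷ s) r eq with () ← ∷ʳ-injectiveʳ (true ∷ s) r eq
zeros-wythoff-∷ʳ-true (true ∷ s)  r eq = zeros-wythoff-∷ true s

iterate-+ : ∀ m n s → iterate (m + n) s ≡ iterate m (iterate n s)
iterate-+ zero    n s = refl
iterate-+ (suc m) n s = cong wythoff (iterate-+ m n s)

zeros≤zeros-iterate : ∀ n s → zeros s ≤ zeros (iterate n s)
zeros≤zeros-iterate zero    s = ≤-refl
zeros≤zeros-iterate (suc n) s = ≤-trans (zeros≤zeros-iterate n s) (zeros≤zeros-wythoff (iterate n s))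

zeros-iterate≤ : ∀ n s → zeros (iterate n s) ≤ n + zeros s
zeros-iterate≤ zero    s = ≤-refl
zeros-iterate≤ (suc n) s = ≤-trans (zeros-wythoff≤ (iterate n s)) (s≤s (zeros-iterate≤ n s))

length-wythoff-cong : ∀ {s t} → length s ≡ length t → length (wythoff s) ≡ length (wythoff t)
length-wythoff-cong {[]}    {[]}    _ = refl
length-wythoff-cong {c ∷ s} {d ∷ t} l = begin
  length (wythoff (c ∷ s)) ≡⟨ length-wythoff-∷ c s ⟩
  suc (suc (length s))     ≡⟨ cong suc l ⟩
  suc (suc (length t))     ≡⟨ sym (length-wythoff-∷ d t) ⟩
  length (wythoff (d ∷ t)) ∎

length-iterate-cong : ∀ n {s t} → length s ≡ length t → length (iterate n s) ≡ length (iterate n t)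
length-iterate-cong zero    l = l
length-iterate-cong (suc n) {s} {t} l = length-wythoff-cong {iterate n s} {iterate n t} (length-iterate-cong n l)

cost : Bitstring → ℕ
cost []          = 0
cost (false ∷ x) = cost x + 2
cost (true ∷ x)  = cost x + 1

expand : Bitstring → Bitstring
expand []          = []
expand (false ∷ x) = false ∷ false ∷ true ∷ expand x
expand (true ∷ x)  = false ∷ true ∷ expand x

cost≡length+zeros : ∀ x → cost x ≡ length x + zeros x
cost≡length+zeros []          = refl
cost≡length+zeros (true ∷ x)  = trans (+-comm (cost x) 1) (cong suc (cost≡length+zeros x))
cost≡length+zeros (false ∷ x) = begin
  cost x + 2                     ≡⟨ +-comm (cost x) 2 ⟩
  suc (suc (cost x))             ≡⟨ cong (suc ∘′ suc) (cost≡length+zeros x) ⟩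
  suc (suc (length x + zeros x)) ≡⟨ cong suc (sym (+-suc (length x) (zeros x))) ⟩
  suc (length x + suc (zeros x)) ∎

zeros-expand : ∀ x → zeros (expand x) ≡ cost x
zeros-expand []          = refl
zeros-expand (true ∷ x)  = trans (cong suc (zeros-expand x)) (+-comm 1 (cost x))
zeros-expand (false ∷ x) = trans (cong (suc ∘′ suc) (zeros-expand x)) (+-comm 2 (cost x))

expand-∷ʳ-true : ∀ c x → ∃[ r ] expand (c ∷ x) ≡ r ∷ʳ true
expand-∷ʳ-true false []      = false ∷ false ∷ [] , refl
expand-∷ʳ-true true  []      = false ∷ [] , refl
expand-∷ʳ-true false (d ∷ x) with r , eq ← expand-∷ʳ-true d x =
  false ∷ false ∷ true ∷ r , cong (λ w → false ∷ false ∷ true ∷ w) eq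
expand-∷ʳ-true true  (d ∷ x) with r , eq ← expand-∷ʳ-true d x =
  false ∷ true ∷ r , cong (λ w → false ∷ true ∷ w) eq

iterate-cost : ∀ x y → iterate (cost x) (x ++ y) ≡ y ++ expand x
iterate-cost []          y = sym (++-identityʳ y)
iterate-cost (true ∷ x)  y = begin
  iterate (cost x + 1) (true ∷ x ++ y)              ≡⟨ iterate-+ (cost x) 1 _ ⟩
  iterate (cost x) ((x ++ y) ++ false ∷ true ∷ [])  ≡⟨ cong (iterate (cost x)) (++-assoc x y _) ⟩
  iterate (cost x) (x ++ y ++ false ∷ true ∷ [])    ≡⟨ iterate-cost x _ ⟩
  (y ++ false ∷ true ∷ []) ++ expand x              ≡⟨ ++-assoc y _ _ ⟩
  y ++ expand (true ∷ x)                            ∎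
iterate-cost (false ∷ x) y = begin
  iterate (cost x + 2) (false ∷ x ++ y)                             ≡⟨ iterate-+ (cost x) 2 _ ⟩
  iterate (cost x) (((x ++ y) ++ false ∷ []) ++ false ∷ true ∷ [])  ≡⟨ cong (iterate (cost x)) (trans (++-assoc (x ++ y) _ _) (++-assoc x y _)) ⟩
  iterate (cost x) (x ++ y ++ false ∷ false ∷ true ∷ [])            ≡⟨ iterate-cost x _ ⟩
  (y ++ false ∷ false ∷ true ∷ []) ++ expand x                      ≡⟨ ++-assoc y _ _ ⟩
  y ++ expand (false ∷ x)                                           ∎

iterate-cost-self : ∀ x → iterate (cost x) x ≡ expand x
iterate-cost-self x = trans (cong (iterate (cost x)) (sym (++-identityʳ x))) (iterate-cost x [])

cost-surplus : ∀ D u v → length u ≡ length v → zeros u ≡ zeros v + suc D →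
  cost u ≡ suc (D + cost v)
cost-surplus D u v l z = begin
  cost u                          ≡⟨ cost≡length+zeros u ⟩
  length u + zeros u              ≡⟨ cong₂ _+_ l z ⟩
  length v + (zeros v + suc D)    ≡⟨ sym (+-assoc (length v) (zeros v) (suc D)) ⟩
  (length v + zeros v) + suc D    ≡⟨ cong (_+ suc D) (sym (cost≡length+zeros v)) ⟩
  cost v + suc D                  ≡⟨ +-suc (cost v) D ⟩
  suc (cost v + D)                ≡⟨ cong suc (+-comm (cost v) D) ⟩
  suc (D + cost v)                ∎

surplus-shrinks : ∀ D u v → length u ≡ length v → zeros u ≡ zeros v + suc D →
  ∃[ E ] E ≤ D × zeros (iterate (cost v) u) ≡ zeros (iterate (cost v) v) + E
surplus-shrinks D []      v l z with () ← m+1+n≢0 (zeros v) (sym z)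
surplus-shrinks D (c ∷ x) v l z = E , E≤D , trans (sym k+E≡a) (cong (_+ E) (sym v-done))
  where
  u = c ∷ x
  k = cost v
  a = zeros (iterate k u)

  v-done : zeros (iterate k v) ≡ k
  v-done = trans (cong zeros (iterate-cost-self v)) (zeros-expand v)

  last-step : wythoff (iterate D (iterate k u)) ≡ expand u
  last-step = begin
    wythoff (iterate D (iterate k u)) ≡⟨ cong wythoff (sym (iterate-+ D k u)) ⟩
    iterate (suc (D + k)) u           ≡⟨ cong (λ n → iterate n u) (sym (cost-surplus D u v l z)) ⟩
    iterate (cost u) u                ≡⟨ iterate-cost-self u ⟩
    expand u                          ∎

  u-almost-done : zeros (iterate D (iterate k u)) ≡ D + k
  u-almost-done with r , eq ← expand-∷ʳ-true c x = suc-injective (begin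
    suc (zeros (iterate D (iterate k u)))     ≡⟨ sym (zeros-wythoff-∷ʳ-true (iterate D (iterate k u)) r
                                                      (trans last-step eq)) ⟩
    zeros (wythoff (iterate D (iterate k u))) ≡⟨ cong zeros last-step ⟩
    zeros (expand u)                          ≡⟨ zeros-expand u ⟩
    cost u                                    ≡⟨ cost-surplus D u v l z ⟩
    suc (D + k)                               ∎)

  a≤D+k : a ≤ D + k
  a≤D+k = subst (a ≤_) u-almost-done (zeros≤zeros-iterate D (iterate k u))

  k≤a : k ≤ a
  k≤a = +-cancelˡ-≤ D k a (subst (_≤ D + a) u-almost-done (zeros-iterate≤ D (iterate k u)))

  E : ℕ
  E = proj₁ (m≤n⇒∃[o]m+o≡n k≤a)

  k+E≡a : k + E ≡ a
  k+E≡a = proj₂ (m≤n⇒∃[o]m+o≡n k≤a)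

  E≤D : E ≤ D
  E≤D = +-cancelˡ-≤ k E D (subst (_≤ k + D) (sym k+E≡a) (subst (a ≤_) (+-comm D k) a≤D+k))

balance : ∀ {D} → Acc _<_ D → ∀ u v → length u ≡ length v → zeros u ≡ zeros v + D →
  ∃[ t ] Balanced (iterate t u) (iterate t v)
balance {zero}  _        u v l z = 0 , balanced-by-zeros {u} {v} l (trans z (+-identityʳ (zeros v)))
balance {suc D} (acc rs) u v l z
  with E , E≤D , z′ ← surplus-shrinks D u v l z
  with t , b ← balance (rs (s≤s E≤D)) (iterate (cost v) u) (iterate (cost v) v) (length-iterate-cong (cost v) l) z′
  = t + cost v , subst₂ Balanced (sym (iterate-+ t (cost v) u)) (sym (iterate-+ t (cost v) v)) b

lemma4 : (S T : Bitstring) → S ≢ [] → T ≢ [] → length S ≡ length T →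
    ∃[ t ] Balanced (iterate t S) (iterate t T)
lemma4 S T _ _ l with ≤-total (zeros T) (zeros S)
... | inj₁ T≤S = balance (<-wellFounded _) S T l (sym (m+[n∸m]≡n T≤S))
... | inj₂ S≤T with t , b ← balance (<-wellFounded _) T S (sym l) (sym (m+[n∸m]≡n S≤T))
  = t , Balanced-sym {iterate t T} {iterate t S} b
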